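{- Let $M$ be a matroid on groundset $[n]$ and $\preceq$ a term order on $\mathbb{R}[x_1,\dots,x_n]$. Then $\mathcal{S}_\preceq(M)=\mathcal{S}_\preceq(M^*)$, where $M^*$ is the dual matroid (whose bases are the complements $[n]\setminus B$ of the bases $B$ of $M$).
   Context: The basis configuration of $M$ is $V_M=\{\mathbf{e}_B:B \text{ a basis of } M\}\subseteq\{0,1\}^n$ with $\mathbf{e}_B$ the characteristic vector of $B$. For finite $V\subseteq\{0,1\}^n$, $\mathcal{S}_\preceq(V)=\{\tau\subseteq[n]:\prod_{i\in\tau}x_i\notin\mathrm{in}_\preceq(I(V))\}$ with $I(V)$ the vanishing ideal of $V$; $\mathcal{S}_\preceq(M):=\mathcal{S}_\preceq(V_M)$.
   Formalization: Polynomials are taken over ℚ in place of ℝ, so the vanishing ideals $I(V)$, their initial ideals and the sets $\mathcal{S}_\preceq$ are formed from rational polynomials. -}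

module Defs where

open import Data.Nat as ℕ using (ℕ; zero; suc)
open import Data.Bool using (Bool; true; false; if_then_else_)
open import Data.Fin using (Fin)
open import Data.Fin.Subset using (Subset; _∈_; _∉_; _∪_; _-_; ⁅_⁆; ∁)
open import Data.Vec using (Vec; []; _∷_; map; zipWith; foldr)
open import Data.Vec.Relation.Binary.Pointwise.Inductive using (Pointwise)
open import Data.Rational as ℚ using (ℚ; 0ℚ; 1ℚ)
open import Data.List as List using (List)
open import Data.Product using (Σ; ∃; _×_; _,_)
open import Relation.Nullary using (¬_; yes; no)
import Data.Vec
import Data.Vec.Properties as VecP
open import Relation.Binary.PropositionalEquality using (_≡_)
open import Relation.Binary.Structures using (IsTotalOrder)
open import Level using (0ℓ)

record Matroid (n : ℕ) : Set₁ where
  field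
    IsBasis   : Subset n → Set
    nonempty  : ∃ λ B → IsBasis B
    exchange  : ∀ B₁ B₂ → IsBasis B₁ → IsBasis B₂ →
                ∀ x → x ∈ B₁ → x ∉ B₂ →
                ∃ λ y → y ∈ B₂ × y ∉ B₁ × IsBasis ((B₁ - x) ∪ ⁅ y ⁆)

DualBasis : ∀ {n} → Matroid n → Subset n → Set
DualBasis M B = Matroid.IsBasis M (∁ B)

Point : ℕ → Set
Point n = Vec ℚ n

charVec : ∀ {n} → Subset n → Point n
charVec = map (λ b → if b then 1ℚ else 0ℚ)

PointSet : ℕ → Set₁
PointSet n = Point n → Set

config : ∀ {n} → (Subset n → Set) → PointSet n
config {n} P v = Σ (Subset n) λ B → P B × charVec B ≡ v

Monomial : ℕ → Set
Monomial n = Vec ℕ n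

-- a polynomial is a finite formal sum of terms c·x^a (repetitions allowed)
Poly : ℕ → Set
Poly n = List (ℚ × Monomial n)

coeff : ∀ {n} → Poly n → Monomial n → ℚ
coeff f a = List.foldr step 0ℚ f
  where
  step : _ → ℚ → ℚ
  step (c , b) s with VecP.≡-dec ℕ._≟_ b a
  ... | yes _ = c ℚ.+ s
  ... | no  _ = s

pow : ℚ → ℕ → ℚ
pow q zero    = 1ℚ
pow q (suc k) = q ℚ.* pow q k

evalMono : ∀ {n} → Monomial n → Point n → ℚ
evalMono a p = foldr _ ℚ._*_ 1ℚ (zipWith pow p a)

eval : ∀ {n} → Poly n → Point n → ℚ
eval f p = List.foldr (λ { (c , a) s → (c ℚ.* evalMono a p) ℚ.+ s }) 0ℚ f

_·_ : ∀ {n} → Monomial n → Monomial n → Monomial n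
_·_ = zipWith ℕ._+_

zeroMono : ∀ {n} → Monomial n
zeroMono = Data.Vec.replicate _ 0

_∣ₘ_ : ∀ {n} → Monomial n → Monomial n → Set
a ∣ₘ b = Pointwise ℕ._≤_ a b

record TermOrder (n : ℕ) : Set₁ where
  field
    _≼_           : Monomial n → Monomial n → Set
    isTotalOrder  : IsTotalOrder _≡_ _≼_
    one-least     : ∀ a → zeroMono ≼ a
    multiplicative : ∀ a b c → a ≼ b → (a · c) ≼ (b · c)

InVanishingIdeal : ∀ {n} → PointSet n → Poly n → Set
InVanishingIdeal V f = ∀ v → V v → eval f v ≡ 0ℚ

IsLeadingMonomial : ∀ {n} → TermOrder n → Poly n → Monomial n → Set
IsLeadingMonomial ≺ f a =
  ¬ (coeff f a ≡ 0ℚ) × (∀ b → ¬ (coeff f b ≡ 0ℚ) → TermOrder._≼_ ≺ b a)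

-- x^m ∈ in_≼(I(V)): the initial ideal is the monomial ideal generated by
-- the leading monomials of nonzero elements of I(V); a monomial lies in it
-- iff it is divisible by one of these generators.
InInitialIdeal : ∀ {n} → TermOrder n → PointSet n → Monomial n → Set
InInitialIdeal ≺ V m =
  ∃ λ f → InVanishingIdeal V f × ∃ λ a → IsLeadingMonomial ≺ f a × a ∣ₘ m

sqfree : ∀ {n} → Subset n → Monomial n
sqfree = map (λ b → if b then 1 else 0)

InS : ∀ {n} → TermOrder n → PointSet n → Subset n → Set
InS ≺ V τ = ¬ InInitialIdeal ≺ V (sqfree τ)

InSMatroid : ∀ {n} → TermOrder n → Matroid n → Subset n → Set
InSMatroid ≺ M = InS ≺ (config (Matroid.IsBasis M))

InSDual : ∀ {n} → TermOrder n → Matroid n → Subset n → Set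
InSDual ≺ M = InS ≺ (config (DualBasis M))

-- The substitution x ↦ 1 − x maps the vanishing ideal of V into that of 1 − V, and it
-- preserves leading monomials for every term order: (1 − x)^b is ±x^b plus a combination of
-- proper divisors of x^b, all of which are smaller than x^b. Hence V and 1 − V have the same
-- initial ideal, and 1 − V_M = V_{M*} since e_{[n]∖B} = 1 − e_B.
module Submission where

open import Defs
open import Data.Nat as ℕ using (ℕ; zero; suc; _≤_; _<_; s≤s)
import Data.Nat.Properties as ℕP
open import Data.Rational using (ℚ; 0ℚ; 1ℚ; _+_; _*_; -_; _-_)
import Data.Rational.Properties as ℚP
open import Data.Rational.Solver using (module +-*-Solver)
open +-*-Solver
open import Data.List using ([]; _∷_; _++_; length)
open import Data.Vec using ([]; _∷_; map; zipWith)
import Data.Vec.Properties as VecP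
open import Data.Vec.Relation.Binary.Pointwise.Inductive using ([]; _∷_)
open import Data.Bool using (true; false; not)
open import Data.Bool.Properties using (not-involutive)
open import Data.Fin.Subset using (Subset; ∁)
open import Data.Product using (_×_; _,_)
open import Data.Sum using (_⊎_; inj₁; inj₂)
open import Data.Empty using (⊥; ⊥-elim)
open import Function using (_∘_)
open import Relation.Nullary using (¬_; yes; no; Dec)
open import Relation.Binary.PropositionalEquality
open import Relation.Binary.Structures using (IsTotalOrder)
open ≡-Reasoning

-- The test made by coeff, so that splitting on b ≟ₘ a makes coeff ((c , b) ∷ f) a compute.
_≟ₘ_ : ∀ {n} (a b : Monomial n) → Dec (a ≡ b)
_≟ₘ_ = VecP.≡-dec ℕ._≟_

*-≡0 : ∀ x y → (¬ x ≡ 0ℚ → ¬ y ≡ 0ℚ → ⊥) → x * y ≡ 0ℚ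
*-≡0 x y h with x ℚP.≟ 0ℚ | y ℚP.≟ 0ℚ
... | yes refl | _        = ℚP.*-zeroˡ y
... | no _     | yes refl = ℚP.*-zeroʳ x
... | no x≢0   | no y≢0   = ⊥-elim (h x≢0 y≢0)

IsSign : ℚ → Set
IsSign s = s ≡ 1ℚ ⊎ s ≡ - 1ℚ

sign-neg : ∀ {s} → IsSign s → IsSign (- s)
sign-neg (inj₁ refl) = inj₂ refl
sign-neg (inj₂ refl) = inj₁ refl

sign-* : ∀ {s t} → IsSign s → IsSign t → IsSign (s * t)
sign-* (inj₁ refl) (inj₁ refl) = inj₁ refl
sign-* (inj₁ refl) (inj₂ refl) = inj₂ refl
sign-* (inj₂ refl) (inj₁ refl) = inj₂ refl
sign-* (inj₂ refl) (inj₂ refl) = inj₁ refl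

*-sign-≡0 : ∀ {s} x → IsSign s → x * s ≡ 0ℚ → x ≡ 0ℚ
*-sign-≡0 x (inj₁ refl) xs≡0 = trans (sym (ℚP.*-identityʳ x)) xs≡0
*-sign-≡0 x (inj₂ refl) xs≡0 = ℚP.neg-injective (begin
  - x          ≡⟨ cong -_ (sym (ℚP.*-identityʳ x)) ⟩
  - (x * 1ℚ)   ≡⟨ ℚP.neg-distribʳ-* x 1ℚ ⟩
  x * - 1ℚ     ≡⟨ xs≡0 ⟩
  0ℚ           ∎)

coeff-∷-≡ : ∀ {n} c (b a : Monomial n) f → b ≡ a → coeff ((c , b) ∷ f) a ≡ c + coeff f a
coeff-∷-≡ c b a f b≡a with b ≟ₘ a
... | yes _   = refl
... | no b≢a  = ⊥-elim (b≢a b≡a)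

coeff-∷-≢ : ∀ {n} c (b a : Monomial n) f → ¬ b ≡ a → coeff ((c , b) ∷ f) a ≡ coeff f a
coeff-∷-≢ c b a f b≢a with b ≟ₘ a
... | yes b≡a = ⊥-elim (b≢a b≡a)
... | no _    = refl

coeff-++ : ∀ {n} (f g : Poly n) a → coeff (f ++ g) a ≡ coeff f a + coeff g a
coeff-++ [] g a = sym (ℚP.+-identityˡ _)
coeff-++ ((c , b) ∷ f) g a with b ≟ₘ a
... | yes _ = trans (cong (c +_) (coeff-++ f g a)) (sym (ℚP.+-assoc c _ _))
... | no _  = coeff-++ f g a

scale : ∀ {n} → ℚ → Poly n → Poly n
scale c [] = []
scale c ((v , m) ∷ f) = (c * v , m) ∷ scale c f

coeff-scale : ∀ {n} c (f : Poly n) a → coeff (scale c f) a ≡ c * coeff f a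
coeff-scale c [] a = sym (ℚP.*-zeroʳ c)
coeff-scale c ((v , m) ∷ f) a with m ≟ₘ a
... | yes _ = trans (cong (c * v +_) (coeff-scale c f a)) (sym (ℚP.*-distribˡ-+ c v _))
... | no _  = coeff-scale c f a

sumWith : ∀ {n} → (Monomial n → ℚ) → Poly n → ℚ
sumWith G [] = 0ℚ
sumWith G ((c , b) ∷ f) = c * G b + sumWith G f

dropMono : ∀ {n} → Monomial n → Poly n → Poly n
dropMono b [] = []
dropMono b ((c , b′) ∷ f) with b′ ≟ₘ b
... | yes _ = dropMono b f
... | no _  = (c , b′) ∷ dropMono b f

sumWith-dropMono : ∀ {n} (G : Monomial n → ℚ) (f : Poly n) b →
                   sumWith G f ≡ coeff f b * G b + sumWith G (dropMono b f)
sumWith-dropMono G [] b = sym (trans (ℚP.+-identityʳ _) (ℚP.*-zeroˡ (G b)))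
sumWith-dropMono G ((c , b′) ∷ f) b with b′ ≟ₘ b
... | yes refl = begin
  c * G b + sumWith G f                              ≡⟨ cong (c * G b +_) (sumWith-dropMono G f b) ⟩
  c * G b + (coeff f b * G b + sumWith G (dropMono b f))
    ≡⟨ solve 4 (λ c g k r → c :* g :+ (k :* g :+ r) := (c :+ k) :* g :+ r) refl
               c (G b) (coeff f b) (sumWith G (dropMono b f)) ⟩
  (c + coeff f b) * G b + sumWith G (dropMono b f)   ∎
... | no b′≢b = begin
  c * G b′ + sumWith G f                              ≡⟨ cong (c * G b′ +_) (sumWith-dropMono G f b) ⟩
  c * G b′ + (coeff f b * G b + sumWith G (dropMono b f))
    ≡⟨ solve 4 (λ x g k r → x :+ (k :* g :+ r) := k :* g :+ (x :+ r)) refl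
               (c * G b′) (G b) (coeff f b) (sumWith G (dropMono b f)) ⟩
  coeff f b * G b + (c * G b′ + sumWith G (dropMono b f)) ∎

coeff-dropMono-≡ : ∀ {n} (f : Poly n) b → coeff (dropMono b f) b ≡ 0ℚ
coeff-dropMono-≡ [] b = refl
coeff-dropMono-≡ ((c , b′) ∷ f) b with b′ ≟ₘ b
... | yes _ = coeff-dropMono-≡ f b
... | no b′≢b = trans (coeff-∷-≢ c b′ b (dropMono b f) b′≢b) (coeff-dropMono-≡ f b)

coeff-dropMono-≢ : ∀ {n} (f : Poly n) b {a} → ¬ a ≡ b → coeff (dropMono b f) a ≡ coeff f a
coeff-dropMono-≢ [] b a≢b = refl
coeff-dropMono-≢ ((c , b′) ∷ f) b {a} a≢b with b′ ≟ₘ b | b′ ≟ₘ a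
... | yes refl | yes refl = ⊥-elim (a≢b refl)
... | yes refl | no _     = coeff-dropMono-≢ f b a≢b
... | no _     | yes b′≡a = trans (coeff-∷-≡ c b′ a (dropMono b f) b′≡a)
                                  (cong (c +_) (coeff-dropMono-≢ f b a≢b))
... | no _     | no b′≢a  = trans (coeff-∷-≢ c b′ a (dropMono b f) b′≢a)
                                  (coeff-dropMono-≢ f b a≢b)

length-dropMono : ∀ {n} (f : Poly n) b → length (dropMono b f) ≤ length f
length-dropMono [] b = ℕ.z≤n
length-dropMono ((c , b′) ∷ f) b with b′ ≟ₘ b
... | yes _ = ℕP.m≤n⇒m≤1+n (length-dropMono f b)
... | no _  = s≤s (length-dropMono f b)

length-dropMono-head : ∀ {n} c (f : Poly n) b → length (dropMono b ((c , b) ∷ f)) ≤ length f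
length-dropMono-head c f b with b ≟ₘ b
... | yes _   = length-dropMono f b
... | no b≢b  = ⊥-elim (b≢b refl)

dropMono-vanishing : ∀ {n} (G : Monomial n → ℚ) (f : Poly n) b →
                     (∀ a → ¬ a ≡ b → coeff f a * G a ≡ 0ℚ) →
                     ∀ a → coeff (dropMono b f) a * G a ≡ 0ℚ
dropMono-vanishing G f b h a with a ≟ₘ b
... | yes refl = trans (cong (_* G a) (coeff-dropMono-≡ f a)) (ℚP.*-zeroˡ (G a))
... | no a≢b   = trans (cong (_* G a) (coeff-dropMono-≢ f b a≢b)) (h a a≢b)

sumWith-vanishing : ∀ {n} (G : Monomial n → ℚ) (f : Poly n) →
                    (∀ b → coeff f b * G b ≡ 0ℚ) → sumWith G f ≡ 0ℚ
sumWith-vanishing {n} G f = go (length f) f ℕP.≤-refl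
  where
  -- dropMono b f is not a subterm of f, so the recursion is on a bound for the length
  go : ∀ k (f : Poly n) → length f ≤ k → (∀ b → coeff f b * G b ≡ 0ℚ) → sumWith G f ≡ 0ℚ
  go _ [] _ _ = refl
  go (suc k) f@((c , b) ∷ f′) (s≤s |f′|≤k) h = begin
    sumWith G f                                  ≡⟨ sumWith-dropMono G f b ⟩
    coeff f b * G b + sumWith G (dropMono b f)
      ≡⟨ cong₂ _+_ (h b) (go k (dropMono b f) (ℕP.≤-trans (length-dropMono-head c f′ b) |f′|≤k)
                             (dropMono-vanishing G f b (λ a _ → h a))) ⟩
    0ℚ                                           ∎

sumWith-single : ∀ {n} (G : Monomial n → ℚ) (f : Poly n) a →
                 (∀ b → ¬ b ≡ a → coeff f b * G b ≡ 0ℚ) → sumWith G f ≡ coeff f a * G a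
sumWith-single G f a h = begin
  sumWith G f                                  ≡⟨ sumWith-dropMono G f a ⟩
  coeff f a * G a + sumWith G (dropMono a f)
    ≡⟨ cong (coeff f a * G a +_) (sumWith-vanishing G (dropMono a f) (dropMono-vanishing G f a h)) ⟩
  coeff f a * G a + 0ℚ                         ≡⟨ ℚP.+-identityʳ _ ⟩
  coeff f a * G a                              ∎

negMulX : Poly 1 → Poly 1
negMulX [] = []
negMulX ((u , j ∷ []) ∷ P) = (- u , suc j ∷ []) ∷ negMulX P

oneMinusXPow : ℕ → Poly 1
oneMinusXPow zero    = (1ℚ , 0 ∷ []) ∷ []
oneMinusXPow (suc k) = oneMinusXPow k ++ negMulX (oneMinusXPow k)

coeff-negMulX-suc : ∀ P j → coeff (negMulX P) (suc j ∷ []) ≡ - coeff P (j ∷ [])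
coeff-negMulX-suc [] j = refl
coeff-negMulX-suc ((u , i ∷ []) ∷ P) j with (i ∷ []) ≟ₘ (j ∷ [])
... | yes i≡j = trans (coeff-∷-≡ (- u) (suc i ∷ []) (suc j ∷ []) (negMulX P) (cong (map suc) i≡j))
                      (trans (cong (- u +_) (coeff-negMulX-suc P j)) (sym (ℚP.neg-distrib-+ u _)))
... | no i≢j  = trans (coeff-∷-≢ (- u) (suc i ∷ []) (suc j ∷ []) (negMulX P) (i≢j ∘ cong (map ℕ.pred)))
                      (coeff-negMulX-suc P j)

coeff-oneMinusXPow-suc : ∀ k j → coeff (oneMinusXPow (suc k)) (suc j ∷ []) ≡
                         coeff (oneMinusXPow k) (suc j ∷ []) - coeff (oneMinusXPow k) (j ∷ [])
coeff-oneMinusXPow-suc k j =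
  trans (coeff-++ P (negMulX P) (suc j ∷ [])) (cong (coeff P (suc j ∷ []) +_) (coeff-negMulX-suc P j))
  where P = oneMinusXPow k

coeff-oneMinusXPow-high : ∀ k j → k < j → coeff (oneMinusXPow k) (j ∷ []) ≡ 0ℚ
coeff-oneMinusXPow-high zero    (suc j) _         = refl
coeff-oneMinusXPow-high (suc k) (suc j) (s≤s k<j) = begin
  coeff (oneMinusXPow (suc k)) (suc j ∷ [])                         ≡⟨ coeff-oneMinusXPow-suc k j ⟩
  coeff (oneMinusXPow k) (suc j ∷ []) - coeff (oneMinusXPow k) (j ∷ [])
    ≡⟨ cong₂ _-_ (coeff-oneMinusXPow-high k (suc j) (ℕP.m<n⇒m<1+n k<j)) (coeff-oneMinusXPow-high k j k<j) ⟩
  0ℚ                                                                ∎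

coeff-oneMinusXPow-≢0⇒≤ : ∀ k j → ¬ coeff (oneMinusXPow k) (j ∷ []) ≡ 0ℚ → j ≤ k
coeff-oneMinusXPow-≢0⇒≤ k j nz with j ℕ.≤? k
... | yes j≤k = j≤k
... | no j≰k  = ⊥-elim (nz (coeff-oneMinusXPow-high k j (ℕP.≰⇒> j≰k)))

sign-coeff-oneMinusXPow-top : ∀ k → IsSign (coeff (oneMinusXPow k) (k ∷ []))
sign-coeff-oneMinusXPow-top zero    = inj₁ refl
sign-coeff-oneMinusXPow-top (suc k) = subst IsSign (sym top≡-prev) (sign-neg (sign-coeff-oneMinusXPow-top k))
  where
  top≡-prev : coeff (oneMinusXPow (suc k)) (suc k ∷ []) ≡ - coeff (oneMinusXPow k) (k ∷ [])
  top≡-prev = trans (coeff-oneMinusXPow-suc k k)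
                (trans (cong (_- coeff (oneMinusXPow k) (k ∷ [])) (coeff-oneMinusXPow-high k (suc k) ℕP.≤-refl))
                       (ℚP.+-identityˡ _))

-- The polynomial (1 − x)ᵇ = ∏ᵢ (1 − xᵢ)^bᵢ and the substitution x ↦ 1 − x

mulHeadTerm : ∀ {n} → ℚ → ℕ → Poly n → Poly (suc n)
mulHeadTerm u j [] = []
mulHeadTerm u j ((v , m) ∷ Q) = (u * v , j ∷ m) ∷ mulHeadTerm u j Q

infixr 7 _⊗_
_⊗_ : ∀ {n} → Poly 1 → Poly n → Poly (suc n)
[] ⊗ Q = []
((u , j ∷ []) ∷ P) ⊗ Q = mulHeadTerm u j Q ++ P ⊗ Q

coeff-mulHeadTerm-≡ : ∀ {n} u {j i} (Q : Poly n) m → j ≡ i →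
                      coeff (mulHeadTerm u j Q) (i ∷ m) ≡ u * coeff Q m
coeff-mulHeadTerm-≡ u [] m _ = sym (ℚP.*-zeroʳ u)
coeff-mulHeadTerm-≡ u {j} {i} ((v , m′) ∷ Q) m j≡i with (j ∷ m′) ≟ₘ (i ∷ m)
... | yes jm′≡im = begin
  u * v + coeff (mulHeadTerm u j Q) (i ∷ m)  ≡⟨ cong (u * v +_) (coeff-mulHeadTerm-≡ u Q m j≡i) ⟩
  u * v + u * coeff Q m                      ≡⟨ sym (ℚP.*-distribˡ-+ u v _) ⟩
  u * (v + coeff Q m)
    ≡⟨ cong (u *_) (sym (coeff-∷-≡ v m′ m Q (VecP.∷-injectiveʳ jm′≡im))) ⟩
  u * coeff ((v , m′) ∷ Q) m                 ∎
... | no jm′≢im  = trans (coeff-mulHeadTerm-≡ u Q m j≡i)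
                         (cong (u *_) (sym (coeff-∷-≢ v m′ m Q (jm′≢im ∘ cong₂ _∷_ j≡i))))

coeff-mulHeadTerm-≢ : ∀ {n} u {j i} (Q : Poly n) m → ¬ j ≡ i →
                      coeff (mulHeadTerm u j Q) (i ∷ m) ≡ 0ℚ
coeff-mulHeadTerm-≢ u [] m _ = refl
coeff-mulHeadTerm-≢ u {j} {i} ((v , m′) ∷ Q) m j≢i =
  trans (coeff-∷-≢ (u * v) (j ∷ m′) (i ∷ m) (mulHeadTerm u j Q) (j≢i ∘ VecP.∷-injectiveˡ))
        (coeff-mulHeadTerm-≢ u Q m j≢i)

coeff-⊗ : ∀ {n} P (Q : Poly n) i m → coeff (P ⊗ Q) (i ∷ m) ≡ coeff P (i ∷ []) * coeff Q m
coeff-⊗ [] Q i m = sym (ℚP.*-zeroˡ (coeff Q m))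
coeff-⊗ ((u , j ∷ []) ∷ P) Q i m with (j ∷ []) ≟ₘ (i ∷ [])
... | yes j≡i = begin
  coeff (mulHeadTerm u j Q ++ P ⊗ Q) (i ∷ m)                ≡⟨ coeff-++ (mulHeadTerm u j Q) (P ⊗ Q) _ ⟩
  coeff (mulHeadTerm u j Q) (i ∷ m) + coeff (P ⊗ Q) (i ∷ m)
    ≡⟨ cong₂ _+_ (coeff-mulHeadTerm-≡ u Q m (VecP.∷-injectiveˡ j≡i)) (coeff-⊗ P Q i m) ⟩
  u * coeff Q m + coeff P (i ∷ []) * coeff Q m                 ≡⟨ sym (ℚP.*-distribʳ-+ (coeff Q m) u _) ⟩
  (u + coeff P (i ∷ [])) * coeff Q m                           ∎
... | no j≢i = begin
  coeff (mulHeadTerm u j Q ++ P ⊗ Q) (i ∷ m)                ≡⟨ coeff-++ (mulHeadTerm u j Q) (P ⊗ Q) _ ⟩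
  coeff (mulHeadTerm u j Q) (i ∷ m) + coeff (P ⊗ Q) (i ∷ m)
    ≡⟨ cong₂ _+_ (coeff-mulHeadTerm-≢ u Q m (j≢i ∘ cong (_∷ []))) (coeff-⊗ P Q i m) ⟩
  0ℚ + coeff P (i ∷ []) * coeff Q m                            ≡⟨ ℚP.+-identityˡ _ ⟩
  coeff P (i ∷ []) * coeff Q m                                 ∎

oneMinusPow : ∀ {n} → Monomial n → Poly n
oneMinusPow []      = (1ℚ , []) ∷ []
oneMinusPow (k ∷ b) = oneMinusXPow k ⊗ oneMinusPow b

coeff-oneMinusPow-≢0⇒∣ : ∀ {n} (b a : Monomial n) → ¬ coeff (oneMinusPow b) a ≡ 0ℚ → a ∣ₘ b
coeff-oneMinusPow-≢0⇒∣ []      []      _  = []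
coeff-oneMinusPow-≢0⇒∣ (k ∷ b) (i ∷ a) nz =
  coeff-oneMinusXPow-≢0⇒≤ k i (λ x≡0 → nz′ (*-≡0 x y (λ x≢0 _ → x≢0 x≡0))) ∷
  coeff-oneMinusPow-≢0⇒∣ b a (λ y≡0 → nz′ (*-≡0 x y (λ _ y≢0 → y≢0 y≡0)))
  where
  x = coeff (oneMinusXPow k) (i ∷ [])
  y = coeff (oneMinusPow b) a
  nz′ : ¬ x * y ≡ 0ℚ
  nz′ = nz ∘ trans (coeff-⊗ (oneMinusXPow k) (oneMinusPow b) i a)

sign-coeff-oneMinusPow-top : ∀ {n} (b : Monomial n) → IsSign (coeff (oneMinusPow b) b)
sign-coeff-oneMinusPow-top []      = inj₁ refl
sign-coeff-oneMinusPow-top (k ∷ b) =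
  subst IsSign (sym (coeff-⊗ (oneMinusXPow k) (oneMinusPow b) k b))
        (sign-* (sign-coeff-oneMinusXPow-top k) (sign-coeff-oneMinusPow-top b))

substOneMinus : ∀ {n} → Poly n → Poly n
substOneMinus [] = []
substOneMinus ((c , b) ∷ f) = scale c (oneMinusPow b) ++ substOneMinus f

coeff-substOneMinus : ∀ {n} (f : Poly n) a →
                      coeff (substOneMinus f) a ≡ sumWith (λ b → coeff (oneMinusPow b) a) f
coeff-substOneMinus [] a = refl
coeff-substOneMinus ((c , b) ∷ f) a =
  trans (coeff-++ (scale c (oneMinusPow b)) (substOneMinus f) a)
        (cong₂ _+_ (coeff-scale c (oneMinusPow b) a) (coeff-substOneMinus f a))

oneMinus : ∀ {n} → Point n → Point n
oneMinus = map (λ x → 1ℚ - x)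

eval-++ : ∀ {n} (f g : Poly n) p → eval (f ++ g) p ≡ eval f p + eval g p
eval-++ [] g p = sym (ℚP.+-identityˡ (eval g p))
eval-++ ((c , b) ∷ f) g p = trans (cong (c * evalMono b p +_) (eval-++ f g p))
                                  (sym (ℚP.+-assoc (c * evalMono b p) (eval f p) (eval g p)))

eval-scale : ∀ {n} c (f : Poly n) p → eval (scale c f) p ≡ c * eval f p
eval-scale c [] p = sym (ℚP.*-zeroʳ c)
eval-scale c ((v , m) ∷ f) p = trans (cong ((c * v) * evalMono m p +_) (eval-scale c f p))
  (solve 4 (λ c v e r → (c :* v) :* e :+ c :* r := c :* (v :* e :+ r)) refl c v (evalMono m p) (eval f p))

eval-negMulX : ∀ P x → eval (negMulX P) (x ∷ []) ≡ - (x * eval P (x ∷ []))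
eval-negMulX [] x = cong -_ (sym (ℚP.*-zeroʳ x))
eval-negMulX ((u , j ∷ []) ∷ P) x = trans (cong (- u * (x * pow x j * 1ℚ) +_) (eval-negMulX P x))
  (solve 4 (λ u x X e → :- u :* (x :* X :* con 1ℚ) :+ :- (x :* e) := :- (x :* (u :* (X :* con 1ℚ) :+ e))) refl
     u x (pow x j) (eval P (x ∷ [])))

eval-oneMinusXPow : ∀ k x → eval (oneMinusXPow k) (x ∷ []) ≡ pow (1ℚ - x) k
eval-oneMinusXPow zero    x = refl
eval-oneMinusXPow (suc k) x = begin
  eval (P ++ negMulX P) (x ∷ [])                       ≡⟨ eval-++ P (negMulX P) (x ∷ []) ⟩
  eval P (x ∷ []) + eval (negMulX P) (x ∷ [])          ≡⟨ cong (eval P (x ∷ []) +_) (eval-negMulX P x) ⟩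
  eval P (x ∷ []) + - (x * eval P (x ∷ []))
    ≡⟨ cong (λ e → e + - (x * e)) (eval-oneMinusXPow k x) ⟩
  pow (1ℚ - x) k + - (x * pow (1ℚ - x) k)
    ≡⟨ solve 2 (λ x e → e :+ :- (x :* e) := (con 1ℚ :- x) :* e) refl x (pow (1ℚ - x) k) ⟩
  pow (1ℚ - x) (suc k)                                 ∎
  where P = oneMinusXPow k

eval-mulHeadTerm : ∀ {n} u j (Q : Poly n) x p →
                   eval (mulHeadTerm u j Q) (x ∷ p) ≡ u * pow x j * eval Q p
eval-mulHeadTerm u j [] x p = sym (ℚP.*-zeroʳ (u * pow x j))
eval-mulHeadTerm u j ((v , m) ∷ Q) x p =
  trans (cong (u * v * (pow x j * evalMono m p) +_) (eval-mulHeadTerm u j Q x p))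
    (solve 5 (λ u v X e r → u :* v :* (X :* e) :+ u :* X :* r := u :* X :* (v :* e :+ r)) refl
       u v (pow x j) (evalMono m p) (eval Q p))

eval-⊗ : ∀ {n} P (Q : Poly n) x p → eval (P ⊗ Q) (x ∷ p) ≡ eval P (x ∷ []) * eval Q p
eval-⊗ [] Q x p = sym (ℚP.*-zeroˡ (eval Q p))
eval-⊗ ((u , j ∷ []) ∷ P) Q x p = begin
  eval (mulHeadTerm u j Q ++ P ⊗ Q) (x ∷ p)          ≡⟨ eval-++ (mulHeadTerm u j Q) (P ⊗ Q) (x ∷ p) ⟩
  eval (mulHeadTerm u j Q) (x ∷ p) + eval (P ⊗ Q) (x ∷ p)
    ≡⟨ cong₂ _+_ (eval-mulHeadTerm u j Q x p) (eval-⊗ P Q x p) ⟩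
  u * pow x j * eval Q p + eval P (x ∷ []) * eval Q p
    ≡⟨ solve 4 (λ u X e r → u :* X :* e :+ r :* e := (u :* (X :* con 1ℚ) :+ r) :* e) refl
         u (pow x j) (eval Q p) (eval P (x ∷ [])) ⟩
  (u * (pow x j * 1ℚ) + eval P (x ∷ [])) * eval Q p  ∎

eval-oneMinusPow : ∀ {n} (b : Monomial n) p → eval (oneMinusPow b) p ≡ evalMono b (oneMinus p)
eval-oneMinusPow []      []      = refl
eval-oneMinusPow (k ∷ b) (x ∷ p) =
  trans (eval-⊗ (oneMinusXPow k) (oneMinusPow b) x p)
        (cong₂ _*_ (eval-oneMinusXPow k x) (eval-oneMinusPow b p))

eval-substOneMinus : ∀ {n} (f : Poly n) p → eval (substOneMinus f) p ≡ eval f (oneMinus p)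
eval-substOneMinus [] p = refl
eval-substOneMinus ((c , b) ∷ f) p =
  trans (eval-++ (scale c (oneMinusPow b)) (substOneMinus f) p)
        (cong₂ _+_ (trans (eval-scale c (oneMinusPow b) p) (cong (c *_) (eval-oneMinusPow b p)))
                   (eval-substOneMinus f p))

-- Leading monomials and initial ideals under x ↦ 1 − x

·-identityˡ : ∀ {n} (a : Monomial n) → zeroMono · a ≡ a
·-identityˡ []      = refl
·-identityˡ (k ∷ a) = cong (k ∷_) (·-identityˡ a)

∣ₘ⇒quotient· : ∀ {n} {a b : Monomial n} → a ∣ₘ b → zipWith ℕ._∸_ b a · a ≡ b
∣ₘ⇒quotient· []          = refl
∣ₘ⇒quotient· (k≤l ∷ a∣b) = cong₂ _∷_ (ℕP.m∸n+n≡m k≤l) (∣ₘ⇒quotient· a∣b)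

module _ {n} (≺ : TermOrder n) where
  open TermOrder ≺
  open IsTotalOrder isTotalOrder using (antisym; total) renaming (trans to ≼-trans)

  ∣ₘ⇒≼ : ∀ {a b : Monomial n} → a ∣ₘ b → a ≼ b
  ∣ₘ⇒≼ {a} {b} a∣b = subst₂ _≼_ (·-identityˡ a) (∣ₘ⇒quotient· a∣b)
    (multiplicative zeroMono (zipWith ℕ._∸_ b a) a (one-least _))

  substOneMinus-leading : ∀ f {a} → IsLeadingMonomial ≺ f a → IsLeadingMonomial ≺ (substOneMinus f) a
  substOneMinus-leading f {a} (lc≢0 , lead-max) = lc′≢0 , lead′-max
    where
    coeff-lead : coeff (substOneMinus f) a ≡ coeff f a * coeff (oneMinusPow a) a
    coeff-lead = trans (coeff-substOneMinus f a) (sumWith-single (λ b → coeff (oneMinusPow b) a) f a off-lead)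
      where
      off-lead : ∀ b → ¬ b ≡ a → coeff f b * coeff (oneMinusPow b) a ≡ 0ℚ
      off-lead b b≢a = *-≡0 _ _ λ fb≢0 eb≢0 →
        b≢a (antisym (lead-max b fb≢0) (∣ₘ⇒≼ (coeff-oneMinusPow-≢0⇒∣ b a eb≢0)))

    lc′≢0 : ¬ coeff (substOneMinus f) a ≡ 0ℚ
    lc′≢0 lc′≡0 =
      lc≢0 (*-sign-≡0 (coeff f a) (sign-coeff-oneMinusPow-top a) (trans (sym coeff-lead) lc′≡0))

    lead′-max : ∀ b → ¬ coeff (substOneMinus f) b ≡ 0ℚ → b ≼ a
    lead′-max b cb≢0 with b ≟ₘ a | total b a
    ... | _        | inj₁ b≼a = b≼a
    ... | yes refl | inj₂ a≼a = a≼a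
    ... | no b≢a   | inj₂ a≼b = ⊥-elim (cb≢0 (trans (coeff-substOneMinus f b)
                                   (sumWith-vanishing (λ b′ → coeff (oneMinusPow b′) b) f terms≡0)))
      where
      -- every monomial of (1 − x)^b′ with b′ in the support of f lies below a, but x^b ≻ a
      terms≡0 : ∀ b′ → coeff f b′ * coeff (oneMinusPow b′) b ≡ 0ℚ
      terms≡0 b′ = *-≡0 _ _ λ fb′≢0 eb′≢0 →
        b≢a (antisym (≼-trans (∣ₘ⇒≼ (coeff-oneMinusPow-≢0⇒∣ b′ b eb′≢0)) (lead-max b′ fb′≢0))
                     a≼b)

  inInitialIdeal-oneMinus : ∀ {V W : PointSet n} → (∀ v → W v → V (oneMinus v)) →
                            ∀ {m} → InInitialIdeal ≺ V m → InInitialIdeal ≺ W m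
  inInitialIdeal-oneMinus W⇒V (f , f∈I[V] , a , lead , a∣m) =
    substOneMinus f , (λ v v∈W → trans (eval-substOneMinus f v) (f∈I[V] (oneMinus v) (W⇒V v v∈W))) ,
    a , substOneMinus-leading f lead , a∣m

  InS-oneMinus : ∀ {V W : PointSet n} → (∀ v → V v → W (oneMinus v)) →
                 ∀ {τ} → InS ≺ V τ → InS ≺ W τ
  InS-oneMinus V⇒W τ∈S[V] = τ∈S[V] ∘ inInitialIdeal-oneMinus V⇒W

oneMinus-charVec : ∀ {n} (B : Subset n) → oneMinus (charVec B) ≡ charVec (∁ B)
oneMinus-charVec []          = refl
oneMinus-charVec (true ∷ B)  = cong (0ℚ ∷_) (oneMinus-charVec B)
oneMinus-charVec (false ∷ B) = cong (1ℚ ∷_) (oneMinus-charVec B)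

∁-involutive : ∀ {n} (B : Subset n) → ∁ (∁ B) ≡ B
∁-involutive B = trans (sym (VecP.map-∘ not not B)) (trans (VecP.map-cong not-involutive B) (VecP.map-id B))

config-oneMinus : ∀ {n} {P Q : Subset n → Set} → (∀ B → P B → Q (∁ B)) →
                  ∀ v → config P v → config Q (oneMinus v)
config-oneMinus P⇒Q∘∁ v (B , PB , refl) = ∁ B , P⇒Q∘∁ B PB , sym (oneMinus-charVec B)

proposition2p6 : (n : ℕ) (M : Matroid n) (≺ : TermOrder n) (τ : Subset n) →
    (InSMatroid ≺ M τ → InSDual ≺ M τ) × (InSDual ≺ M τ → InSMatroid ≺ M τ)
proposition2p6 n M ≺ τ =
  InS-oneMinus ≺ (config-oneMinus basis⇒dualBasis) , InS-oneMinus ≺ (config-oneMinus dualBasis⇒basis)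
  where
  open Matroid M using (IsBasis)

  basis⇒dualBasis : ∀ B → IsBasis B → DualBasis M (∁ B)
  basis⇒dualBasis B = subst IsBasis (sym (∁-involutive B))

  dualBasis⇒basis : ∀ B → DualBasis M B → IsBasis (∁ B)
  dualBasis⇒basis B B∈M* = B∈M*
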